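{- Fix positive integers $k,m\in\mathbb{N}$ with $\gcd(k,m)=1$. For each integer $n\geq 0$ let $$T_n^{(k,m)}=\sum_{\substack{x,y\in\{0,1,2,\ldots\}\\ kx+my=n}}\binom{x+y}{x}$$ be the sum of the entries of Pascal's triangle $(x,y)\mapsto\binom{x+y}{x}$ lying on the diagonal $kx+my=n$. Then for all $n=0,1,2,\ldots$, $$T_n^{(k,m)}=\sum_{j=0}^{\lfloor (n+m)/k\rfloor}\binom{\left\lfloor \frac{n-jk}{m}\right\rfloor+j+1}{j+1}-\sum_{j=0}^{\lfloor (n+m-1)/k\rfloor}\binom{\left\lfloor \frac{n-1-jk}{m}\right\rfloor+j+1}{j+1}.$$
   Context: $\lfloor\cdot\rfloor$ denotes the floor function (so e.g. $\lfloor -1/2\rfloor=-1$). In the sums, the upper argument of each binomial coefficient is a nonnegative integer, and $\binom{a}{b}$ is the usual binomial coefficient for integers $a\ge 0$, $b\ge 1$, equal to $0$ when $a<b$. The sum defining $T_n^{(k,m)}$ ranges over all pairs of nonnegative integers $(x,y)$ with $kx+my=n$ (an empty sum is $0$). -}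

module Defs where

open import Data.Nat using (ℕ; zero; suc; _+_; _*_; _≟_)
open import Data.List using (List; map; upTo)
open import Data.Nat.ListAction using (sum)
open import Data.Product using (_×_; _,_)
open import Data.Nat.Combinatorics using (_C_)
open import Relation.Nullary using (yes; no)

sumTo : ℕ → (ℕ → ℕ) → ℕ
sumTo N f = sum (map f (upTo (suc N)))

term : ℕ → ℕ → ℕ → ℕ → ℕ → ℕ
term k m n x y with k * x + m * y ≟ n
... | yes _ = (x + y) C x
... | no  _ = 0

-- T_n^{(k,m)} = Σ_{x,y ≥ 0, k x + m y = n} binom(x+y, x).
-- For k, m ≥ 1 every solution has x ≤ n and y ≤ n, so enumerating
-- (x , y) ∈ [0..n] × [0..n] covers all pairs of nonnegative integers.
T : ℕ → ℕ → ℕ → ℕ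
T k m n = sumTo n (λ x → sumTo n (λ y → term k m n x y))

module Submission where

-- Split T_n^{(k,m)} into columns x = j of Pascal's triangle:
-- column j meets the diagonal k x + m y = n in at most one entry C(j + y, j).
-- For a level N put
--   cumulative N j = C(⌊(N ∸ jk)/m⌋ + j, j + 1).
-- By the hockey-stick identity, cumulative (n + m) j is the sum of the entries
-- C(j + y, j) of column j with jk + my ≤ n, and cumulative (n + m ∸ 1) j the
-- same sum with jk + my ≤ n - 1, so their difference is the diagonal entry
-- of column j (or 0).  We prove this difference directly from Pascal's rule
-- (cumulative-step) and sum it over the columns j ≤ n + m.  Finally the
-- integer floors of the theorem satisfy ⌊(z - jk)/m⌋ + 1 = ⌊(z + m - jk)/m⌋
-- (floor-shift), which identifies its two sums with the sums of cumulative at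
-- the levels n + m and n + m ∸ 1.

open import Defs
open import Data.Nat using (ℕ; NonZero; nonZero; _/_; _*_; _%_; suc; zero; _+_; _∸_; _≤_; _<_; _≤′_; ≤′-refl; ≤′-step; s≤s; z<s; _≤?_)
open import Data.Nat.GCD using (gcd)
open import Data.Nat.Properties
open import Data.Nat.DivMod using (m≡m%n+[m/n]*n; m%n<n; m*n%n≡0; m*n/n≡m; n/n≡1; m<n⇒m/n≡0; m<n⇒m%n≡m; n%n≡0; m/n≤m; m/n*n≤m; /-monoˡ-≤; +-distrib-/-∣ʳ)
open import Data.Nat.Divisibility using (∣-refl; n∣m*n)
open import Data.Nat.Combinatorics using (_C_; nCk+nC[k+1]≡[n+1]C[k+1]; k>n⇒nCk≡0)
open import Data.Nat.ListAction using (sum)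
open import Data.Nat.ListAction.Properties using (sum-++)
import Data.Nat.Tactic.RingSolver as ℕ-Solver
open import Data.Integer using (ℤ; +_; -[1+_]; _-_; ∣_∣; _⊖_; 0ℤ; 1ℤ; -1ℤ) renaming (_+_ to _+ℤ_)
open import Data.Integer.DivMod using (_/ℕ_)
open import Data.Integer.Properties using (+-injective; [+m]-[+n]≡m⊖n; ⊖-≥)
open import Data.Integer.Tactic.RingSolver using (solve-∀)
open import Data.List using (applyUpTo; _∷ʳ_; [_])
open import Data.List.Properties using (map-upTo; applyUpTo-∷ʳ)
open import Data.Sum using (inj₁; inj₂)
open import Algebra.Properties.CommutativeSemigroup +-commutativeSemigroup using (interchange)
open import Relation.Nullary using (yes; no; contradiction)
open import Relation.Binary.PropositionalEquality using (_≡_; _≢_; refl; sym; trans; cong; cong₂; subst; module ≡-Reasoning)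
open ≡-Reasoning

Σ< : ℕ → (ℕ → ℕ) → ℕ
Σ< zero    f = 0
Σ< (suc n) f = Σ< n f + f n

sum-applyUpTo : ∀ n f → sum (applyUpTo f n) ≡ Σ< n f
sum-applyUpTo zero    f = refl
sum-applyUpTo (suc n) f = begin
  sum (applyUpTo f (suc n))        ≡⟨ cong sum (applyUpTo-∷ʳ f n) ⟨
  sum (applyUpTo f n ∷ʳ f n)       ≡⟨ sum-++ (applyUpTo f n) [ f n ] ⟩
  sum (applyUpTo f n) + (f n + 0)  ≡⟨ cong₂ _+_ (sum-applyUpTo n f) (+-identityʳ (f n)) ⟩
  Σ< n f + f n                     ∎

sumTo≡Σ< : ∀ N f → sumTo N f ≡ Σ< (suc N) f
sumTo≡Σ< N f = trans (cong sum (map-upTo f (suc N))) (sum-applyUpTo (suc N) f)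

Σ<-cong : ∀ n {f g} → (∀ i → i < n → f i ≡ g i) → Σ< n f ≡ Σ< n g
Σ<-cong zero    eq = refl
Σ<-cong (suc n) eq = cong₂ _+_ (Σ<-cong n (λ i i<n → eq i (m<n⇒m<1+n i<n))) (eq n ≤-refl)

Σ<-+ : ∀ n f g → Σ< n (λ i → f i + g i) ≡ Σ< n f + Σ< n g
Σ<-+ zero    f g = refl
Σ<-+ (suc n) f g =
  trans (cong (_+ (f n + g n)) (Σ<-+ n f g)) (interchange (Σ< n f) (Σ< n g) (f n) (g n))

Σ<-zero : ∀ n {f} → (∀ i → i < n → f i ≡ 0) → Σ< n f ≡ 0
Σ<-zero zero    vanish = refl
Σ<-zero (suc n) vanish =
  cong₂ _+_ (Σ<-zero n (λ i i<n → vanish i (m<n⇒m<1+n i<n))) (vanish n ≤-refl)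

Σ<-extend : ∀ {a b} f → a ≤ b → (∀ i → a ≤ i → f i ≡ 0) → Σ< b f ≡ Σ< a f
Σ<-extend {a} f a≤b vanish = go (≤⇒≤′ a≤b)
  where
  go : ∀ {b} → a ≤′ b → Σ< b f ≡ Σ< a f
  go ≤′-refl = refl
  go {suc b} (≤′-step a≤′b) = begin
    Σ< b f + f b  ≡⟨ cong₂ _+_ (go a≤′b) (vanish b (≤′⇒≤ a≤′b)) ⟩
    Σ< a f + 0    ≡⟨ +-identityʳ (Σ< a f) ⟩
    Σ< a f        ∎

Σ<-single : ∀ n {f} y → y < n → (∀ i → i ≢ y → f i ≡ 0) → Σ< n f ≡ f y
Σ<-single n {f} y y<n others = begin
  Σ< n f        ≡⟨ Σ<-extend f y<n (λ i y<i → others i (>⇒≢ y<i)) ⟩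
  Σ< y f + f y  ≡⟨ cong (_+ f y) (Σ<-zero y (λ i i<y → others i (<⇒≢ i<y))) ⟩
  f y           ∎

/-unique : ∀ {m} .{{_ : NonZero m}} r q → r < m → (r + q * m) / m ≡ q
/-unique {m} r q r<m = begin
  (r + q * m) / m    ≡⟨ +-distrib-/-∣ʳ r (n∣m*n q) ⟩
  r / m + q * m / m  ≡⟨ cong₂ _+_ (m<n⇒m/n≡0 r<m) (m*n/n≡m q m) ⟩
  q                  ∎

[d+m]/m≡1+d/m : ∀ d m .{{_ : NonZero m}} → (d + m) / m ≡ suc (d / m)
[d+m]/m≡1+d/m d m = begin
  (d + m) / m    ≡⟨ +-distrib-/-∣ʳ d ∣-refl ⟩
  d / m + m / m  ≡⟨ cong (λ x → d / m + x) (n/n≡1 m) ⟩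
  d / m + 1      ≡⟨ +-comm (d / m) 1 ⟩
  suc (d / m)    ∎

floor-pred-exact : ∀ d m' → d % suc m' ≡ 0 → (d + m') / suc m' ≡ d / suc m'
floor-pred-exact d m' d%m≡0 = begin
  (d + m') / m                   ≡⟨ cong (λ x → (x + m') / m) (m≡m%n+[m/n]*n d m) ⟩
  (d % m + d / m * m + m') / m   ≡⟨ cong (λ r → (r + d / m * m + m') / m) d%m≡0 ⟩
  (d / m * m + m') / m           ≡⟨ cong (_/ m) (+-comm (d / m * m) m') ⟩
  (m' + d / m * m) / m           ≡⟨ /-unique m' (d / m) (n<1+n m') ⟩
  d / m                          ∎
  where m = suc m'

floor-pred-inexact : ∀ d m' {r} → d % suc m' ≡ suc r → (d + m') / suc m' ≡ suc (d / suc m')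
floor-pred-inexact d m' {r} d%m≡1+r = begin
  (d + m') / m                  ≡⟨ cong (λ x → (x + m') / m) (m≡m%n+[m/n]*n d m) ⟩
  (d % m + d / m * m + m') / m  ≡⟨ cong (λ x → (x + d / m * m + m') / m) d%m≡1+r ⟩
  (suc r + d / m * m + m') / m  ≡⟨ cong (_/ m) (regroup r (d / m) m') ⟩
  (r + suc (d / m) * m) / m     ≡⟨ /-unique r (suc (d / m)) r<m ⟩
  suc (d / m)                   ∎
  where
  m = suc m'
  r<m : r < m
  r<m = <-trans (n<1+n r) (subst (_< m) d%m≡1+r (m%n<n d m))
  regroup : ∀ r q m' → suc r + q * suc m' + m' ≡ r + suc q * suc m'
  regroup = ℕ-Solver.solve-∀

floor-zero : ∀ {m} .{{_ : NonZero m}} N a → N < a + m → (N ∸ a) / m ≡ 0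
floor-zero N a N<a+m = m<n⇒m/n≡0 (m<n+o⇒m∸n<o N a N<a+m)

neg-small-div : ∀ {a m} .{{_ : NonZero m}} → suc a ≤ m → -[1+ a ] /ℕ m ≡ -1ℤ
neg-small-div {a} sa≤m with m≤n⇒m<n∨m≡n sa≤m
... | inj₂ refl rewrite n%n≡0 (suc a) ⦃ nonZero ⦄ | n/n≡1 (suc a) ⦃ nonZero ⦄ = refl
... | inj₁ sa<m rewrite m<n⇒m%n≡m sa<m | m<n⇒m/n≡0 sa<m = refl

floor-shift : ∀ {m} .{{_ : NonZero m}} z {c} → z +ℤ + m ≡ + c → z /ℕ m +ℤ 1ℤ ≡ + (c / m)
floor-shift {m} (+ a) {c} a+m≡c = begin
  + (a / m + 1)    ≡⟨ cong +_ (+-comm (a / m) 1) ⟩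
  + suc (a / m)    ≡⟨ cong +_ ([d+m]/m≡1+d/m a m) ⟨
  + ((a + m) / m)  ≡⟨ cong (λ x → + (x / m)) (+-injective a+m≡c) ⟩
  + (c / m)        ∎
floor-shift {m} -[1+ a ] {c} z+m≡c = begin
  -[1+ a ] /ℕ m +ℤ 1ℤ  ≡⟨ cong (_+ℤ 1ℤ) (neg-small-div (subst (suc a ≤_) (sym m≡c+1+a) (m≤n+m (suc a) c))) ⟩
  0ℤ                   ≡⟨ cong +_ (m<n⇒m/n≡0 (subst (c <_) (sym m≡c+1+a) (m<m+n c z<s))) ⟨
  + (c / m)            ∎
  where
  cancel : ∀ x y → x +ℤ y - x ≡ y
  cancel = solve-∀
  m≡c+1+a : m ≡ c + suc a
  m≡c+1+a = +-injective (trans (sym (cancel -[1+ a ] (+ m))) (cong (_- -[1+ a ]) z+m≡c))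

term-hit : ∀ k m n x y → k * x + m * y ≡ n → term k m n x y ≡ (x + y) C x
term-hit k m n x y on with k * x + m * y ≟ n
... | yes _  = refl
... | no off = contradiction on off

term-miss : ∀ k m n x y → k * x + m * y ≢ n → term k m n x y ≡ 0
term-miss k m n x y off with k * x + m * y ≟ n
... | yes on = contradiction on off
... | no _   = refl

column : ℕ → ℕ → ℕ → ℕ → ℕ
column k m n j = Σ< (suc n) (term k m n j)

column-hit : ∀ k m .{{_ : NonZero m}} n j y → k * j + m * y ≡ n → column k m n j ≡ (j + y) C j
column-hit k m n j y on = trans (Σ<-single (suc n) y (s≤s y≤n) others) (term-hit k m n j y on)
  where
  y≤n : y ≤ n
  y≤n = ≤-trans (m≤n*m y m) (subst (m * y ≤_) on (m≤n+m (m * y) (k * j)))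
  others : ∀ i → i ≢ y → term k m n j i ≡ 0
  others i i≢y = term-miss k m n j i
    (λ on′ → i≢y (*-cancelˡ-≡ i y m (+-cancelˡ-≡ (k * j) (m * i) (m * y) (trans on′ (sym on)))))

column-miss : ∀ k m n j → (∀ y → k * j + m * y ≢ n) → column k m n j ≡ 0
column-miss k m n j off = Σ<-zero (suc n) (λ y _ → term-miss k m n j y (off y))

on-diagonal : ∀ k m .{{_ : NonZero m}} n j → j * k ≤ n → (n ∸ j * k) % m ≡ 0 →
  k * j + m * ((n ∸ j * k) / m) ≡ n
on-diagonal k m n j jk≤n rem = begin
  k * j + m * q            ≡⟨ cong₂ _+_ (*-comm k j) (*-comm m q) ⟩
  j * k + q * m            ≡⟨ cong (λ r → j * k + (r + q * m)) rem ⟨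
  j * k + (d % m + q * m)  ≡⟨ cong (λ x → j * k + x) (m≡m%n+[m/n]*n d m) ⟨
  j * k + d                ≡⟨ m+[n∸m]≡n jk≤n ⟩
  n                        ∎
  where
  d = n ∸ j * k
  q = d / m

off-diagonal : ∀ k m .{{_ : NonZero m}} n j {r} → (n ∸ j * k) % m ≡ suc r → ∀ y → k * j + m * y ≢ n
off-diagonal k m n j {r} rem y on = 1+n≢0 (begin
  suc r                        ≡⟨ rem ⟨
  (n ∸ j * k) % m              ≡⟨ cong (λ x → (x ∸ j * k) % m) on ⟨
  (k * j + m * y ∸ j * k) % m  ≡⟨ cong₂ (λ a b → (a + b ∸ j * k) % m) (*-comm k j) (*-comm m y) ⟩
  (j * k + y * m ∸ j * k) % m  ≡⟨ cong (_% m) (m+n∸m≡n (j * k) (y * m)) ⟩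
  y * m % m                    ≡⟨ m*n%n≡0 y m ⟩
  0                            ∎)

below-diagonal : ∀ k m n j → n < j * k → ∀ y → k * j + m * y ≢ n
below-diagonal k m n j n<jk y on =
  <⇒≱ n<jk (subst (j * k ≤_) on (subst (_≤ k * j + m * y) (*-comm k j) (m≤m+n (k * j) (m * y))))

T-by-columns : ∀ k m .{{_ : NonZero k}} n B → n ≤ B → T k m n ≡ Σ< (suc B) (column k m n)
T-by-columns k m n B n≤B = begin
  T k m n                       ≡⟨ sumTo≡Σ< n _ ⟩
  Σ< (suc n) (λ j → sumTo n (term k m n j))
    ≡⟨ Σ<-cong (suc n) (λ j _ → sumTo≡Σ< n (term k m n j)) ⟩
  Σ< (suc n) (column k m n)     ≡⟨ Σ<-extend (column k m n) (s≤s n≤B) empty ⟨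
  Σ< (suc B) (column k m n)     ∎
  where
  empty : ∀ j → n < j → column k m n j ≡ 0
  empty j n<j = column-miss k m n j (below-diagonal k m n j (<-≤-trans n<j (m≤m*n j k)))

-- C(⌊(N ∸ jk)/m⌋ + j, j + 1); for N = n + m this is, by the hockey-stick
-- identity, the sum of the entries C(j + y, j) with jk + my ≤ n.
cumulative : (k m : ℕ) → .{{_ : NonZero m}} → ℕ → ℕ → ℕ
cumulative k m N j = ((N ∸ j * k) / m + j) C (j + 1)

cumulative-vanishes : ∀ k m .{{_ : NonZero m}} N j → N < j * k + m → cumulative k m N j ≡ 0
cumulative-vanishes k m N j N<jk+m
  rewrite floor-zero N (j * k) N<jk+m = k>n⇒nCk≡0 (m<m+n j z<s)

pascal : ∀ q j → (suc q + j) C (j + 1) ≡ (q + j) C (j + 1) + (j + q) C j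
pascal q j rewrite +-comm j 1 | +-comm j q =
  trans (sym (nCk+nC[k+1]≡[n+1]C[k+1] (q + j) j)) (+-comm ((q + j) C j) ((q + j) C suc j))

n+[1+m]∸1≡n+m : ∀ n m → n + suc m ∸ 1 ≡ n + m
n+[1+m]∸1≡n+m n m = cong (_∸ 1) (+-suc n m)

upper-floor : ∀ k m .{{_ : NonZero m}} n j → j * k ≤ n → (n + m ∸ j * k) / m ≡ suc ((n ∸ j * k) / m)
upper-floor k m n j jk≤n = trans (cong (_/ m) (+-∸-comm m jk≤n)) ([d+m]/m≡1+d/m (n ∸ j * k) m)

lower-floor : ∀ k m' n j → j * k ≤ n → (n + suc m' ∸ 1 ∸ j * k) / suc m' ≡ (n ∸ j * k + m') / suc m'
lower-floor k m' n j jk≤n =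
  cong (_/ suc m') (trans (cong (_∸ j * k) (n+[1+m]∸1≡n+m n m')) (+-∸-comm m' jk≤n))

cumulative-step : ∀ k m' n j → let m = suc m' in
  cumulative k m (n + m) j ≡ cumulative k m (n + m ∸ 1) j + column k m n j
cumulative-step k m' n j with j * k ≤? n
... | no jk≰n = begin
  cumulative k m (n + m) j                       ≡⟨ cumulative-vanishes k m (n + m) j (+-monoˡ-< m n<jk) ⟩
  0                                              ≡⟨ cong₂ _+_ lower-vanishes (column-miss k m n j (below-diagonal k m n j n<jk)) ⟨
  cumulative k m (n + m ∸ 1) j + column k m n j  ∎
  where
  m = suc m'
  n<jk : n < j * k
  n<jk = ≰⇒> jk≰n
  lower-vanishes : cumulative k m (n + m ∸ 1) j ≡ 0
  lower-vanishes = cumulative-vanishes k m (n + m ∸ 1) j (≤-<-trans (m∸n≤m (n + m) 1) (+-monoˡ-< m n<jk))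
... | yes jk≤n with (n ∸ j * k) % suc m' in rem
...   | zero = begin
  cumulative k m (n + m) j                       ≡⟨ cong (λ x → (x + j) C (j + 1)) (upper-floor k m n j jk≤n) ⟩
  (suc q + j) C (j + 1)                          ≡⟨ pascal q j ⟩
  (q + j) C (j + 1) + (j + q) C j                ≡⟨ cong₂ (λ x c → (x + j) C (j + 1) + c) lower hit ⟨
  cumulative k m (n + m ∸ 1) j + column k m n j  ∎
  where
  m = suc m'
  q = (n ∸ j * k) / m
  lower : (n + m ∸ 1 ∸ j * k) / m ≡ q
  lower = trans (lower-floor k m' n j jk≤n) (floor-pred-exact (n ∸ j * k) m' rem)
  hit : column k m n j ≡ (j + q) C j
  hit = column-hit k m n j q (on-diagonal k m n j jk≤n rem)
...   | suc r = begin
  cumulative k m (n + m) j                       ≡⟨ cong (λ x → (x + j) C (j + 1)) (trans upper (sym lower)) ⟩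
  cumulative k m (n + m ∸ 1) j                   ≡⟨ +-identityʳ _ ⟨
  cumulative k m (n + m ∸ 1) j + 0               ≡⟨ cong (λ c → cumulative k m (n + m ∸ 1) j + c) miss ⟨
  cumulative k m (n + m ∸ 1) j + column k m n j  ∎
  where
  m = suc m'
  upper : (n + m ∸ j * k) / m ≡ suc ((n ∸ j * k) / m)
  upper = upper-floor k m n j jk≤n
  lower : (n + m ∸ 1 ∸ j * k) / m ≡ suc ((n ∸ j * k) / m)
  lower = trans (lower-floor k m' n j jk≤n) (floor-pred-inexact (n ∸ j * k) m' rem)
  miss : column k m n j ≡ 0
  miss = column-miss k m n j (off-diagonal k m n j rem)

levels-differ-by-diagonal : ∀ k m' n B → let m = suc m' in
  Σ< B (cumulative k m (n + m)) ≡ Σ< B (cumulative k m (n + m ∸ 1)) + Σ< B (column k m n)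
levels-differ-by-diagonal k m' n B =
  trans (Σ<-cong B (λ j _ → cumulative-step k m' n j)) (Σ<-+ B _ _)

summand≡cumulative : ∀ k m .{{_ : NonZero m}} z R j → z +ℤ + m ≡ + R → j * k ≤ R →
  ∣ ((z - + (j * k)) /ℕ m) +ℤ + j +ℤ + 1 ∣ C (j + 1) ≡ cumulative k m R j
summand≡cumulative k m z R j z+m≡R jk≤R = cong (_C (j + 1)) (begin
  ∣ w /ℕ m +ℤ + j +ℤ 1ℤ ∣    ≡⟨ cong ∣_∣ (reorder (w /ℕ m) (+ j)) ⟩
  ∣ w /ℕ m +ℤ 1ℤ +ℤ + j ∣    ≡⟨ cong (λ x → ∣ x +ℤ + j ∣) (floor-shift w w+m≡R-jk) ⟩
  (R ∸ j * k) / m + j        ∎)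
  where
  w = z - + (j * k)
  reorder : ∀ x y → x +ℤ y +ℤ 1ℤ ≡ x +ℤ 1ℤ +ℤ y
  reorder = solve-∀
  swap : ∀ x y u → x - y +ℤ u ≡ x +ℤ u - y
  swap = solve-∀
  w+m≡R-jk : w +ℤ + m ≡ + (R ∸ j * k)
  w+m≡R-jk = begin
    z - + (j * k) +ℤ + m  ≡⟨ swap z (+ (j * k)) (+ m) ⟩
    z +ℤ + m - + (j * k)  ≡⟨ cong (_- + (j * k)) z+m≡R ⟩
    + R - + (j * k)       ≡⟨ [+m]-[+n]≡m⊖n R (j * k) ⟩
    R ⊖ j * k             ≡⟨ ⊖-≥ jk≤R ⟩
    + (R ∸ j * k)         ∎

side≡Σcumulative : ∀ k m .{{_ : NonZero k}} .{{_ : NonZero m}} z R B → z +ℤ + m ≡ + R → R ≤ B →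
  sumTo (R / k) (λ j → ∣ ((z - + (j * k)) /ℕ m) +ℤ + j +ℤ + 1 ∣ C (j + 1))
    ≡ Σ< (suc B) (cumulative k m R)
side≡Σcumulative k m z R B z+m≡R R≤B = begin
  sumTo (R / k) summand             ≡⟨ sumTo≡Σ< (R / k) summand ⟩
  Σ< (suc (R / k)) summand          ≡⟨ Σ<-cong (suc (R / k)) (λ j j≤R/k →
                                        summand≡cumulative k m z R j z+m≡R (jk≤R (≤-pred j≤R/k))) ⟩
  Σ< (suc (R / k)) (cumulative k m R) ≡⟨ Σ<-extend (cumulative k m R) (s≤s (≤-trans (m/n≤m R k) R≤B)) vanish ⟨
  Σ< (suc B) (cumulative k m R)     ∎
  where
  summand : ℕ → ℕ
  summand j = ∣ ((z - + (j * k)) /ℕ m) +ℤ + j +ℤ + 1 ∣ C (j + 1)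
  jk≤R : ∀ {j} → j ≤ R / k → j * k ≤ R
  jk≤R j≤R/k = ≤-trans (*-monoˡ-≤ k j≤R/k) (m/n*n≤m R k)
  vanish : ∀ j → suc (R / k) ≤ j → cumulative k m R j ≡ 0
  vanish j R/k<j = cumulative-vanishes k m R j (<-≤-trans R<jk (m≤m+n (j * k) m))
    where
    R<jk : R < j * k
    R<jk = ≰⇒> (λ jk≤R′ → <⇒≱ R/k<j (subst (_≤ R / k) (m*n/n≡m j k) (/-monoˡ-≤ k jk≤R′)))

+c≡+a-+b : ∀ {a} b {c} → a ≡ b + c → + c ≡ + a - + b
+c≡+a-+b {a} b {c} a≡b+c = trans (sym (cancel (+ b) (+ c))) (cong (λ x → + x - + b) (sym a≡b+c))
  where
  cancel : ∀ x y → x +ℤ y - x ≡ y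
  cancel = solve-∀

theorem2 : (k m : ℕ) → .{{_ : NonZero k}} → .{{_ : NonZero m}} → gcd k m ≡ 1 → (n : ℕ) →
    + T k m n
      ≡ + sumTo ((n Data.Nat.+ m) / k)
              (λ j → ∣ ((+ n - + (j * k)) /ℕ m) +ℤ + j +ℤ + 1 ∣ C (j Data.Nat.+ 1))
        - + sumTo ((n Data.Nat.+ m Data.Nat.∸ 1) / k)
              (λ j → ∣ ((+ n - + 1 - + (j * k)) /ℕ m) +ℤ + j +ℤ + 1 ∣ C (j Data.Nat.+ 1))
-- m = 0 is excluded by NonZero m.
theorem2 k zero ⦃ _ ⦄ ⦃ () ⦄ _ n
theorem2 k m@(suc m') _ n = begin
  + T k m n
    ≡⟨ cong +_ (T-by-columns k m n R (m≤m+n n m)) ⟩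
  + Σ< (suc R) (column k m n)
    ≡⟨ +c≡+a-+b (Σ< (suc R) (cumulative k m R′)) (levels-differ-by-diagonal k m' n (suc R)) ⟩
  + Σ< (suc R) (cumulative k m R) - + Σ< (suc R) (cumulative k m R′)
    ≡⟨ cong₂ (λ a b → + a - + b) (side≡Σcumulative k m (+ n) R R refl ≤-refl)
                                 (side≡Σcumulative k m (+ n - + 1) R′ R lower-level (m∸n≤m R 1)) ⟨
  + sumTo (R / k) (summand (+ n)) - + sumTo (R′ / k) (summand (+ n - + 1)) ∎
  where
  R = n + m
  R′ = n + m ∸ 1
  summand : ℤ → ℕ → ℕ
  summand z j = ∣ ((z - + (j * k)) /ℕ m) +ℤ + j +ℤ + 1 ∣ C (j + 1)
  shift : ∀ a b → a - + 1 +ℤ (+ 1 +ℤ b) ≡ a +ℤ b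
  shift = solve-∀
  lower-level : + n - + 1 +ℤ + m ≡ + R′
  lower-level = trans (shift (+ n) (+ m')) (cong +_ (sym (n+[1+m]∸1≡n+m n m')))
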